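{- Let the rational functions $\overline{V}_k(q),\overline{W}_k(q)$, $k\ge1$, be defined by $\overline{V}_1(q)=2q$, $\overline{W}_1(q)=\frac{q}{1+q^2}$, and for $k>1$ \[ \overline{V}_{k}(q)=\frac{(q^{2k-1}-q)\overline{V}_{k-1}(q)+2q^k(1+q^2)}{1+q^{2k}},\qquad \overline{W}_{k}(q)=\frac{(q^{2k-1}-q)\overline{W}_{k-1}(q)+q^{2k-1}}{1+q^{2k}}. \] Then for every positive integer $k$, \[ \overline{V}_{k}(q)=(1+q^2)\left(\frac{2q^{k}}{1+q^{2k}}+2q^k\frac{(q^2;q^2)_{k-1}}{(-q^2;q^2)_{k}}\sum_{j=0}^{k-2}(-1)^{j+1}\frac{(-q^2;q^2)_{k-j-2}}{(q^2;q^2)_{k-j-2}}\right), \] \[ \overline{W}_{k}(q)=\frac{q^{2k-1}}{1+q^{2k}}+q^{2k-2}\frac{(q^2;q^2)_{k-1}}{(-q^2;q^2)_{k}}\sum_{j=0}^{k-2}\frac{(-1)^{j+1}}{q^j}\frac{(-q^2;q^2)_{k-j-2}}{(q^2;q^2)_{k-j-2}}. \]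
   Context: Notation: $(a;q^2)_N=\prod_{j=0}^{N-1}(1-aq^{2j})$, with $(a;q^2)_0=1$; an empty sum equals $0$. -}

module Defs where

open import Data.Nat using (ℕ; zero; suc)
import Data.Nat as ℕ
open import Data.Rational using (ℚ; 0ℚ; 1ℚ; _+_; _*_; _-_; -_; 1/_; ≢-nonZero)
open import Data.Rational.Properties using (_≟_)
open import Relation.Nullary using (yes; no)

_^_ : ℚ → ℕ → ℚ
x ^ zero  = 1ℚ
x ^ suc n = x * (x ^ n)

infixr 8 _^_

2ℚ : ℚ
2ℚ = 1ℚ + 1ℚ

-- total inverse (inv 0 = 0); only ever applied to nonzero values under
-- the hypotheses of the theorem
inv : ℚ → ℚ
inv p with p ≟ 0ℚ
... | yes _ = 0ℚ
... | no p≢0 = 1/_ p {{≢-nonZero p≢0}}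

_÷'_ : ℚ → ℚ → ℚ
x ÷' y = x * inv y

infixl 7 _÷'_

poch : ℚ → ℚ → ℕ → ℚ
poch a q zero    = 1ℚ
poch a q (suc N) = poch a q N * (1ℚ - a * q ^ (2 ℕ.* N))

sumTo : ℕ → (ℕ → ℚ) → ℚ
sumTo zero    f = 0ℚ
sumTo (suc n) f = sumTo n f + f n

sgn : ℕ → ℚ
sgn j = (- 1ℚ) ^ j

-- \overline{V}_k(q) for k ≥ 1 (the value at k = 0 is an unused dummy 0)
Vbar : ℚ → ℕ → ℚ
Vbar q zero = 0ℚ
Vbar q (suc zero) = 2ℚ * q
Vbar q (suc (suc n)) =
  let k = suc (suc n) in
  ((q ^ (2 ℕ.* k ℕ.∸ 1) - q) * Vbar q (suc n) + 2ℚ * q ^ k * (1ℚ + q ^ 2))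
    ÷' (1ℚ + q ^ (2 ℕ.* k))

-- \overline{W}_k(q) for k ≥ 1 (the value at k = 0 is an unused dummy 0)
Wbar : ℚ → ℕ → ℚ
Wbar q zero = 0ℚ
Wbar q (suc zero) = q ÷' (1ℚ + q ^ 2)
Wbar q (suc (suc n)) =
  let k = suc (suc n) in
  ((q ^ (2 ℕ.* k ℕ.∸ 1) - q) * Wbar q (suc n) + q ^ (2 ℕ.* k ℕ.∸ 1))
    ÷' (1ℚ + q ^ (2 ℕ.* k))

Vrhs : ℚ → ℕ → ℚ
Vrhs q k =
  (1ℚ + q ^ 2) *
    ( (2ℚ * q ^ k) ÷' (1ℚ + q ^ (2 ℕ.* k))
    + 2ℚ * q ^ k * (poch (q ^ 2) q (k ℕ.∸ 1) ÷' poch (- (q ^ 2)) q k)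
        * sumTo (k ℕ.∸ 1) (λ j →
            sgn (suc j) * (poch (- (q ^ 2)) q (k ℕ.∸ j ℕ.∸ 2)
                             ÷' poch (q ^ 2) q (k ℕ.∸ j ℕ.∸ 2))))

Wrhs : ℚ → ℕ → ℚ
Wrhs q k =
  q ^ (2 ℕ.* k ℕ.∸ 1) ÷' (1ℚ + q ^ (2 ℕ.* k))
  + q ^ (2 ℕ.* k ℕ.∸ 2) * (poch (q ^ 2) q (k ℕ.∸ 1) ÷' poch (- (q ^ 2)) q k)
      * sumTo (k ℕ.∸ 1) (λ j →
          (sgn (suc j) ÷' q ^ j) * (poch (- (q ^ 2)) q (k ℕ.∸ j ℕ.∸ 2)
                                     ÷' poch (q ^ 2) q (k ℕ.∸ j ℕ.∸ 2)))

{-# OPTIONS --safe #-}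

-- Write x_k = q^{2k}, A_n = (q²;q²)_n / (-q²;q²)_{n+1} (prefactor) and
-- S_n = Σ_{j<n} c_j H_{n-1-j} (weightedSum) with H_m = (-q²;q²)_m / (q²;q²)_m (ratio).
-- Both right-hand sides have the shape w_k G_k with
--   G_k = 1/(1+x_k) - ρ A_{k-1} S_{k-1},   where c_0 = -1 and c_{j+1} = ρ c_j:
-- ρ = -1, w_k = 2q^k(1+q²) for V̄, and ρ = -1/q, w_k = q^{2k-1} for W̄.
-- Splitting off the j = 0 term gives S_{n+1} = ρ S_n - H_n, and A_{n+1} H_n collapses to
-- (1-x_{n+1}) / ((1+x_{n+1})(1+x_{n+2})) — this needs (q²;q²)_n ≠ 0, i.e. q² ≠ 1.
-- Hence G_{k+1} (1 + x_{k+1}) = 1 + ρ (1 - x_k) G_k, and since ρ w_{k+1} = -q w_k the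
-- product w_k G_k satisfies the defining recurrence of V̄ and W̄ and agrees with them at k = 1.

module Submission where

open import Defs
open import Data.Nat using (ℕ; _≤_; zero; suc)
import Data.Nat as ℕ
import Data.Nat.Properties as ℕ
open import Data.Rational
  using (ℚ; 0ℚ; 1ℚ; _*_; _+_; _-_; -_; NonNegative; Positive; nonNegative; nonPositive; ≢-nonZero)
open import Data.Rational.Properties
  using (_≟_; 1≢0; ≤-total; <⇒≢; positive⁻¹; *-inverseˡ; *-comm; *-assoc; *-identityˡ; *-identityʳ;
         *-zeroˡ; *-zeroʳ; *-distribˡ-+; +-assoc; nonNeg*nonNeg⇒nonNeg; nonPos*nonPos⇒nonPos; pos+nonNeg⇒pos)
open import Data.Rational.Solver using (module +-*-Solver)
open import Data.Product using (_×_; _,_)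
open import Data.Sum using (inj₁; inj₂)
open import Relation.Nullary using (Dec; yes; no; contradiction)
open import Relation.Binary.PropositionalEquality
open ≡-Reasoning
open +-*-Solver

inv-inverseˡ : ∀ {p} → p ≢ 0ℚ → inv p * p ≡ 1ℚ
inv-inverseˡ {p} p≢0 with p ≟ 0ℚ
... | yes p≡0 = contradiction p≡0 p≢0
... | no  _   = *-inverseˡ p {{≢-nonZero p≢0}}

inv-inverseʳ : ∀ {p} → p ≢ 0ℚ → p * inv p ≡ 1ℚ
inv-inverseʳ {p} p≢0 = trans (*-comm p (inv p)) (inv-inverseˡ p≢0)

*-≢0 : ∀ {p r} → p ≢ 0ℚ → r ≢ 0ℚ → p * r ≢ 0ℚ
*-≢0 {p} {r} p≢0 r≢0 pr≡0 = r≢0 (begin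
  r                ≡⟨ sym (*-identityˡ r) ⟩
  1ℚ * r           ≡⟨ cong (_* r) (sym (inv-inverseˡ p≢0)) ⟩
  (inv p * p) * r  ≡⟨ *-assoc (inv p) p r ⟩
  inv p * (p * r)  ≡⟨ cong (inv p *_) pr≡0 ⟩
  inv p * 0ℚ       ≡⟨ *-zeroʳ (inv p) ⟩
  0ℚ               ∎)

inv-distrib-* : ∀ p r → inv (p * r) ≡ inv p * inv r
inv-distrib-* p r = by-cases (p ≟ 0ℚ) (r ≟ 0ℚ)
  where
  by-cases : Dec (p ≡ 0ℚ) → Dec (r ≡ 0ℚ) → inv (p * r) ≡ inv p * inv r
  by-cases (yes refl) _ = trans (cong inv (*-zeroˡ r)) (sym (*-zeroˡ (inv r)))
  by-cases (no _) (yes refl) = trans (cong inv (*-zeroʳ p)) (sym (*-zeroʳ (inv p)))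
  by-cases (no p≢0) (no r≢0) = begin
    inv (p * r)                                  ≡⟨ sym (*-identityʳ (inv (p * r))) ⟩
    inv (p * r) * 1ℚ                             ≡⟨ cong (inv (p * r) *_) (sym pr*[inv-p*inv-r]≡1) ⟩
    inv (p * r) * ((p * r) * (inv p * inv r))    ≡⟨ sym (*-assoc (inv (p * r)) (p * r) _) ⟩
    (inv (p * r) * (p * r)) * (inv p * inv r)    ≡⟨ cong (_* (inv p * inv r)) (inv-inverseˡ (*-≢0 p≢0 r≢0)) ⟩
    1ℚ * (inv p * inv r)                         ≡⟨ *-identityˡ (inv p * inv r) ⟩
    inv p * inv r                                ∎
    where
    pr*[inv-p*inv-r]≡1 : (p * r) * (inv p * inv r) ≡ 1ℚ
    pr*[inv-p*inv-r]≡1 = begin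
      (p * r) * (inv p * inv r)
        ≡⟨ solve 4 (λ p r i j → (p :* r) :* (i :* j) := (i :* p) :* (j :* r)) refl p r (inv p) (inv r) ⟩
      (inv p * p) * (inv r * r)    ≡⟨ cong₂ _*_ (inv-inverseˡ p≢0) (inv-inverseˡ r≢0) ⟩
      1ℚ * 1ℚ                      ≡⟨⟩
      1ℚ                           ∎

pos⇒≢0 : ∀ {p} → Positive p → p ≢ 0ℚ
pos⇒≢0 {p} p>0 p≡0 = <⇒≢ (positive⁻¹ p {{p>0}}) (sym p≡0)

1+nonNeg≢0 : ∀ {p} → NonNegative p → 1ℚ + p ≢ 0ℚ
1+nonNeg≢0 {p} p≥0 = pos⇒≢0 (pos+nonNeg⇒pos 1ℚ p {{p≥0}})

square-nonNeg : ∀ q → NonNegative (q * q)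
square-nonNeg q with ≤-total 0ℚ q
... | inj₁ 0≤q = nonNeg*nonNeg⇒nonNeg q {{nonNegative 0≤q}} q {{nonNegative 0≤q}}
... | inj₂ q≤0 = nonPos*nonPos⇒nonPos q {{nonPositive q≤0}} q {{nonPositive q≤0}}

^-nonNeg : ∀ {s} → NonNegative s → ∀ m → NonNegative (s ^ m)
^-nonNeg s≥0 zero    = _
^-nonNeg {s} s≥0 (suc m) = nonNeg*nonNeg⇒nonNeg s {{s≥0}} (s ^ m) {{^-nonNeg s≥0 m}}

^-2*≡square^ : ∀ q m → q ^ (2 ℕ.* m) ≡ (q * q) ^ m
^-2*≡square^ q zero    = refl
^-2*≡square^ q (suc m) = begin
  q ^ (2 ℕ.* suc m)          ≡⟨ cong (q ^_) (ℕ.*-suc 2 m) ⟩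
  q * (q * q ^ (2 ℕ.* m))    ≡⟨ sym (*-assoc q q _) ⟩
  (q * q) * q ^ (2 ℕ.* m)    ≡⟨ cong ((q * q) *_) (^-2*≡square^ q m) ⟩
  (q * q) * (q * q) ^ m      ∎

^-2*suc : ∀ q m → q ^ (2 ℕ.* suc m) ≡ q ^ 2 * q ^ (2 ℕ.* m)
^-2*suc q m = begin
  q ^ (2 ℕ.* suc m)          ≡⟨ cong (q ^_) (ℕ.*-suc 2 m) ⟩
  q * (q * q ^ (2 ℕ.* m))
    ≡⟨ solve 2 (λ q y → q :* (q :* y) := (q :* (q :* con 1ℚ)) :* y) refl q (q ^ (2 ℕ.* m)) ⟩
  q ^ 2 * q ^ (2 ℕ.* m)      ∎

^-2*suc∸1 : ∀ q m → q ^ (2 ℕ.* suc m ℕ.∸ 1) ≡ q * q ^ (2 ℕ.* m)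
^-2*suc∸1 q m = cong (λ e → q ^ (e ℕ.∸ 1)) (ℕ.*-suc 2 m)

^-2*suc∸2 : ∀ q m → q ^ (2 ℕ.* suc m ℕ.∸ 2) ≡ q ^ (2 ℕ.* m)
^-2*suc∸2 q m = cong (λ e → q ^ (e ℕ.∸ 2)) (ℕ.*-suc 2 m)

sumTo-cong : ∀ n {f g : ℕ → ℚ} → (∀ j → f j ≡ g j) → sumTo n f ≡ sumTo n g
sumTo-cong zero    f≗g = refl
sumTo-cong (suc n) f≗g = cong₂ _+_ (sumTo-cong n f≗g) (f≗g n)

*-distribˡ-sumTo : ∀ c n (f : ℕ → ℚ) → c * sumTo n f ≡ sumTo n (λ j → c * f j)
*-distribˡ-sumTo c zero    f = *-zeroʳ c
*-distribˡ-sumTo c (suc n) f = begin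
  c * (sumTo n f + f n)          ≡⟨ *-distribˡ-+ c (sumTo n f) (f n) ⟩
  c * sumTo n f + c * f n        ≡⟨ cong (_+ c * f n) (*-distribˡ-sumTo c n f) ⟩
  sumTo n (λ j → c * f j) + c * f n ∎

sumTo-sucˡ : ∀ n (f : ℕ → ℚ) → sumTo (suc n) f ≡ f 0 + sumTo n (λ j → f (suc j))
sumTo-sucˡ zero    f = solve 1 (λ a → con 0ℚ :+ a := a :+ con 0ℚ) refl (f 0)
sumTo-sucˡ (suc n) f = begin
  sumTo (suc n) f + f (suc n)                        ≡⟨ cong (_+ f (suc n)) (sumTo-sucˡ n f) ⟩
  (f 0 + sumTo n (λ j → f (suc j))) + f (suc n)      ≡⟨ +-assoc (f 0) _ (f (suc n)) ⟩
  f 0 + (sumTo n (λ j → f (suc j)) + f (suc n))      ∎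

geometric-sum : ∀ s m → (1ℚ - s) * sumTo m (s ^_) ≡ 1ℚ - s ^ m
geometric-sum s zero    = solve 1 (λ s → (con 1ℚ :- s) :* con 0ℚ := con 1ℚ :- con 1ℚ) refl s
geometric-sum s (suc m) = begin
  (1ℚ - s) * (sumTo m (s ^_) + s ^ m)               ≡⟨ *-distribˡ-+ (1ℚ - s) _ (s ^ m) ⟩
  (1ℚ - s) * sumTo m (s ^_) + (1ℚ - s) * s ^ m      ≡⟨ cong (_+ (1ℚ - s) * s ^ m) (geometric-sum s m) ⟩
  (1ℚ - s ^ m) + (1ℚ - s) * s ^ m
    ≡⟨ solve 2 (λ s y → (con 1ℚ :- y) :+ (con 1ℚ :- s) :* y := con 1ℚ :- s :* y) refl s (s ^ m) ⟩
  1ℚ - s * s ^ m                                    ∎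

geometric-sum-pos : ∀ {s} → NonNegative s → ∀ m → Positive (sumTo (suc m) (s ^_))
geometric-sum-pos s≥0 zero    = _
geometric-sum-pos {s} s≥0 (suc m) =
  pos+nonNeg⇒pos (sumTo (suc m) (s ^_)) {{geometric-sum-pos s≥0 m}} (s ^ suc m) {{^-nonNeg {s} s≥0 (suc m)}}

1-^suc≢0 : ∀ {s} → NonNegative s → s ≢ 1ℚ → ∀ m → 1ℚ - s ^ suc m ≢ 0ℚ
1-^suc≢0 {s} s≥0 s≢1 m =
  subst (_≢ 0ℚ) (geometric-sum s (suc m)) (*-≢0 1-s≢0 (pos⇒≢0 (geometric-sum-pos s≥0 m)))
  where
  1-s≢0 : 1ℚ - s ≢ 0ℚ
  1-s≢0 1-s≡0 = s≢1 (begin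
    s                 ≡⟨ solve 1 (λ s → s := con 1ℚ :- (con 1ℚ :- s)) refl s ⟩
    1ℚ - (1ℚ - s)     ≡⟨ cong (_-_ 1ℚ) 1-s≡0 ⟩
    1ℚ - 0ℚ           ≡⟨⟩
    1ℚ                ∎)

solution-as-product : ∀ {a b d : ℕ → ℚ} {ρ : ℚ} (w g f : ℕ → ℚ) →
  (∀ n → w (suc n) * ρ * b n ≡ a n * w n) →
  (∀ n → g (suc n) ≡ (1ℚ + ρ * (b n * g n)) * d n) →
  (∀ n → f (suc n) ≡ (a n * f n + w (suc n)) * d n) →
  f 0 ≡ w 0 * g 0 → ∀ n → f n ≡ w n * g n
solution-as-product {a} {b} {d} {ρ} w g f weight g-suc f-suc f₀ = go
  where
  go : ∀ n → f n ≡ w n * g n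
  go zero    = f₀
  go (suc n) = begin
    f (suc n)
      ≡⟨ f-suc n ⟩
    (a n * f n + w (suc n)) * d n
      ≡⟨ cong (λ u → (a n * u + w (suc n)) * d n) (go n) ⟩
    (a n * (w n * g n) + w (suc n)) * d n
      ≡⟨ cong (λ u → (u + w (suc n)) * d n) (sym (*-assoc (a n) (w n) (g n))) ⟩
    (a n * w n * g n + w (suc n)) * d n
      ≡⟨ cong (λ u → (u * g n + w (suc n)) * d n) (sym (weight n)) ⟩
    (w (suc n) * ρ * b n * g n + w (suc n)) * d n
      ≡⟨ solve 5 (λ w′ ρ b g d → (w′ :* ρ :* b :* g :+ w′) :* d := w′ :* ((con 1ℚ :+ ρ :* (b :* g)) :* d))
               refl (w (suc n)) ρ (b n) (g n) (d n) ⟩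
    w (suc n) * ((1ℚ + ρ * (b n * g n)) * d n)
      ≡⟨ cong (w (suc n) *_) (sym (g-suc n)) ⟩
    w (suc n) * g (suc n)
      ∎

module _ (q : ℚ) where

  private
    x : ℕ → ℚ
    x k = q ^ (2 ℕ.* k)

    P M : ℕ → ℚ
    P = poch (q ^ 2) q
    M = poch (- (q ^ 2)) q

    a b d : ℕ → ℚ
    a n = q ^ (2 ℕ.* suc (suc n) ℕ.∸ 1) - q
    b n = 1ℚ - x (suc n)
    d n = inv (1ℚ + x (suc (suc n)))

  1+x≢0 : ∀ m → 1ℚ + x m ≢ 0ℚ
  1+x≢0 m =
    1+nonNeg≢0 {x m} (subst NonNegative (sym (^-2*≡square^ q m)) (^-nonNeg (square-nonNeg q) m))

  1-x≢0 : q * q ≢ 1ℚ → ∀ m → 1ℚ - x (suc m) ≢ 0ℚ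
  1-x≢0 q²≢1 m =
    subst (λ y → 1ℚ - y ≢ 0ℚ) (sym (^-2*≡square^ q (suc m))) (1-^suc≢0 (square-nonNeg q) q²≢1 m)

  P-suc : ∀ n → P (suc n) ≡ P n * (1ℚ - x (suc n))
  P-suc n = cong (λ y → P n * (1ℚ - y)) (sym (^-2*suc q n))

  M-suc : ∀ n → M (suc n) ≡ M n * (1ℚ + x (suc n))
  M-suc n = cong (M n *_) (begin
    1ℚ - - (q ^ 2) * x n
      ≡⟨ solve 2 (λ p y → con 1ℚ :- (:- p) :* y := con 1ℚ :+ p :* y) refl (q ^ 2) (x n) ⟩
    1ℚ + q ^ 2 * x n
      ≡⟨ cong (1ℚ +_) (sym (^-2*suc q n)) ⟩
    1ℚ + x (suc n)
      ∎)

  P≢0 : q * q ≢ 1ℚ → ∀ n → P n ≢ 0ℚ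
  P≢0 q²≢1 zero    = 1≢0
  P≢0 q²≢1 (suc n) = subst (_≢ 0ℚ) (sym (P-suc n)) (*-≢0 (P≢0 q²≢1 n) (1-x≢0 q²≢1 n))

  M≢0 : ∀ n → M n ≢ 0ℚ
  M≢0 zero    = 1≢0
  M≢0 (suc n) = subst (_≢ 0ℚ) (sym (M-suc n)) (*-≢0 (M≢0 n) (1+x≢0 (suc n)))

  ratio : ℕ → ℚ
  ratio m = M m ÷' P m

  prefactor : ℕ → ℚ
  prefactor n = P n ÷' M (suc n)

  prefactor-suc : ∀ n → prefactor (suc n) ≡ prefactor n * b n * d n
  prefactor-suc n = begin
    P (suc n) * inv (M (suc (suc n)))
      ≡⟨ cong₂ (λ u v → u * inv v) (P-suc n) (M-suc (suc n)) ⟩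
    P n * (1ℚ - x (suc n)) * inv (M (suc n) * (1ℚ + x (suc (suc n))))
      ≡⟨ cong (P n * (1ℚ - x (suc n)) *_) (inv-distrib-* (M (suc n)) _) ⟩
    P n * (1ℚ - x (suc n)) * (inv (M (suc n)) * inv (1ℚ + x (suc (suc n))))
      ≡⟨ solve 4 (λ p e i j → p :* e :* (i :* j) := p :* i :* e :* j)
               refl (P n) (1ℚ - x (suc n)) (inv (M (suc n))) (inv (1ℚ + x (suc (suc n)))) ⟩
    P n * inv (M (suc n)) * (1ℚ - x (suc n)) * inv (1ℚ + x (suc (suc n)))
      ∎

  prefactor*ratio : q * q ≢ 1ℚ → ∀ n → prefactor n * ratio n ≡ inv (1ℚ + x (suc n))
  prefactor*ratio q²≢1 n = begin
    P n * inv (M (suc n)) * (M n * inv (P n))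
      ≡⟨ cong (λ u → P n * inv u * (M n * inv (P n))) (M-suc n) ⟩
    P n * inv (M n * (1ℚ + x (suc n))) * (M n * inv (P n))
      ≡⟨ cong (λ u → P n * u * (M n * inv (P n))) (inv-distrib-* (M n) _) ⟩
    P n * (inv (M n) * inv (1ℚ + x (suc n))) * (M n * inv (P n))
      ≡⟨ solve 5 (λ p m i j k → p :* (i :* k) :* (m :* j) := (j :* p) :* (i :* m) :* k)
               refl (P n) (M n) (inv (M n)) (inv (P n)) (inv (1ℚ + x (suc n))) ⟩
    (inv (P n) * P n) * (inv (M n) * M n) * inv (1ℚ + x (suc n))
      ≡⟨ cong₂ (λ u v → u * v * inv (1ℚ + x (suc n)))
               (inv-inverseˡ (P≢0 q²≢1 n)) (inv-inverseˡ (M≢0 n)) ⟩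
    1ℚ * 1ℚ * inv (1ℚ + x (suc n))
      ≡⟨ *-identityˡ _ ⟩
    inv (1ℚ + x (suc n))
      ∎

  weightedSum : (ℕ → ℚ) → ℕ → ℚ
  weightedSum c n = sumTo n (λ j → c j * ratio (suc n ℕ.∸ j ℕ.∸ 2))

  G : ℚ → (ℕ → ℚ) → ℕ → ℚ
  G ρ c n = inv (1ℚ + x (suc n)) - ρ * (prefactor n * weightedSum c n)

  module _ (ρ : ℚ) (c : ℕ → ℚ) (c₀ : c 0 ≡ - 1ℚ) (c-suc : ∀ j → c (suc j) ≡ ρ * c j) where

    weightedSum-suc : ∀ n → weightedSum c (suc n) ≡ ρ * weightedSum c n - ratio n
    weightedSum-suc n = begin
      weightedSum c (suc n)
        ≡⟨ sumTo-sucˡ n _ ⟩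
      c 0 * ratio n + sumTo n (λ j → c (suc j) * ratio (suc n ℕ.∸ j ℕ.∸ 2))
        ≡⟨ cong₂ _+_ (cong (_* ratio n) c₀)
                     (sumTo-cong n λ j → trans (cong (_* _) (c-suc j)) (*-assoc ρ (c j) _)) ⟩
      - 1ℚ * ratio n + sumTo n (λ j → ρ * (c j * ratio (suc n ℕ.∸ j ℕ.∸ 2)))
        ≡⟨ cong (- 1ℚ * ratio n +_) (sym (*-distribˡ-sumTo ρ n _)) ⟩
      - 1ℚ * ratio n + ρ * weightedSum c n
        ≡⟨ solve 3 (λ r ρ s → con (- 1ℚ) :* r :+ ρ :* s := ρ :* s :- r) refl (ratio n) ρ (weightedSum c n) ⟩
      ρ * weightedSum c n - ratio n
        ∎

    G-suc : q * q ≢ 1ℚ → ∀ n → G ρ c (suc n) ≡ (1ℚ + ρ * (b n * G ρ c n)) * d n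
    G-suc q²≢1 n = begin
      d n - ρ * (prefactor (suc n) * weightedSum c (suc n))
        ≡⟨ cong₂ (λ u v → d n - ρ * (u * v)) (prefactor-suc n) (weightedSum-suc n) ⟩
      d n - ρ * (p * b n * d n * (ρ * s - r))
        ≡⟨ solve 6 (λ d ρ p b s r → d :- ρ :* (p :* b :* d :* (ρ :* s :- r))
                                    := d :- ρ :* (b :* d :* (ρ :* (p :* s) :- p :* r)))
                 refl (d n) ρ p (b n) s r ⟩
      d n - ρ * (b n * d n * (ρ * (p * s) - p * r))
        ≡⟨ cong (λ u → d n - ρ * (b n * d n * (ρ * (p * s) - u))) (prefactor*ratio q²≢1 n) ⟩
      d n - ρ * (b n * d n * (ρ * (p * s) - i))
        ≡⟨ solve 6 (λ d ρ p b s i → d :- ρ :* (b :* d :* (ρ :* (p :* s) :- i))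
                                    := (con 1ℚ :+ ρ :* (b :* (i :- ρ :* (p :* s)))) :* d)
                 refl (d n) ρ p (b n) s i ⟩
      (1ℚ + ρ * (b n * (i - ρ * (p * s)))) * d n
        ∎
      where
      p s r i : ℚ
      p = prefactor n
      s = weightedSum c n
      r = ratio n
      i = inv (1ℚ + x (suc n))

  V-coeff : ℕ → ℚ
  V-coeff j = sgn (suc j)

  V-weight : ℕ → ℚ
  V-weight n = 2ℚ * q ^ suc n * (1ℚ + q ^ 2)

  V-weight-suc : ∀ n → V-weight (suc n) * - 1ℚ * b n ≡ a n * V-weight n
  V-weight-suc n = begin
    V-weight (suc n) * - 1ℚ * (1ℚ - x (suc n))
      ≡⟨ solve 4 (λ q t p y → con 2ℚ :* (q :* t) :* (con 1ℚ :+ p) :* con (- 1ℚ) :* (con 1ℚ :- y)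
                              := (q :* y :- q) :* (con 2ℚ :* t :* (con 1ℚ :+ p)))
               refl q (q ^ suc n) (q ^ 2) (x (suc n)) ⟩
    (q * x (suc n) - q) * V-weight n
      ≡⟨ cong (λ u → (u - q) * V-weight n) (sym (^-2*suc∸1 q (suc n))) ⟩
    (q ^ (2 ℕ.* suc (suc n) ℕ.∸ 1) - q) * V-weight n
      ∎

  Vbar-closed-form : q * q ≢ 1ℚ → ∀ n → Vbar q (suc n) ≡ V-weight n * G (- 1ℚ) V-coeff n
  Vbar-closed-form q²≢1 =
    solution-as-product {a} {b} {d} V-weight (G (- 1ℚ) V-coeff) (λ n → Vbar q (suc n))
      V-weight-suc (G-suc (- 1ℚ) V-coeff refl (λ _ → refl) q²≢1) (λ _ → refl) (sym base)
    where
    base : V-weight 0 * G (- 1ℚ) V-coeff 0 ≡ Vbar q 1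
    base = begin
      V-weight 0 * G (- 1ℚ) V-coeff 0
        ≡⟨ solve 4 (λ q p i a → con 2ℚ :* (q :* con 1ℚ) :* (con 1ℚ :+ p) :* (i :- con (- 1ℚ) :* (a :* con 0ℚ))
                                := con 2ℚ :* q :* ((con 1ℚ :+ p) :* i))
                 refl q (q ^ 2) (inv (1ℚ + q ^ 2)) (prefactor 0) ⟩
      2ℚ * q * ((1ℚ + q ^ 2) * inv (1ℚ + q ^ 2))
        ≡⟨ cong (2ℚ * q *_) (inv-inverseʳ (1+x≢0 1)) ⟩
      2ℚ * q * 1ℚ
        ≡⟨ *-identityʳ (2ℚ * q) ⟩
      2ℚ * q
        ∎

  Vrhs-closed-form : ∀ n → Vrhs q (suc n) ≡ V-weight n * G (- 1ℚ) V-coeff n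
  Vrhs-closed-form n =
    solve 5 (λ t p i a s → (con 1ℚ :+ p) :* ((con 2ℚ :* t) :* i :+ con 2ℚ :* t :* a :* s)
                           := con 2ℚ :* t :* (con 1ℚ :+ p) :* (i :- con (- 1ℚ) :* (a :* s)))
      refl (q ^ suc n) (q ^ 2) (inv (1ℚ + x (suc n))) (prefactor n) (weightedSum V-coeff n)

  W-coeff : ℕ → ℚ
  W-coeff j = sgn (suc j) ÷' q ^ j

  W-coeff-suc : ∀ j → W-coeff (suc j) ≡ - inv q * W-coeff j
  W-coeff-suc j = begin
    (- 1ℚ * sgn (suc j)) * inv (q * q ^ j)
      ≡⟨ cong ((- 1ℚ * sgn (suc j)) *_) (inv-distrib-* q (q ^ j)) ⟩
    (- 1ℚ * sgn (suc j)) * (inv q * inv (q ^ j))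
      ≡⟨ solve 3 (λ σ i j → (con (- 1ℚ) :* σ) :* (i :* j) := :- i :* (σ :* j)) refl (sgn (suc j)) (inv q) (inv (q ^ j)) ⟩
    - inv q * (sgn (suc j) * inv (q ^ j))
      ∎

  W-weight : ℕ → ℚ
  W-weight n = q ^ (2 ℕ.* suc n ℕ.∸ 1)

  W-weight-suc : q ≢ 0ℚ → ∀ n → W-weight (suc n) * - inv q * b n ≡ a n * W-weight n
  W-weight-suc q≢0 n = begin
    W-weight (suc n) * - inv q * b n
      ≡⟨ cong (λ u → u * - inv q * b n) (^-2*suc∸1 q (suc n)) ⟩
    q * x (suc n) * - inv q * b n
      ≡⟨ solve 4 (λ q y i b → q :* y :* (:- i) :* b := :- (q :* i) :* y :* b) refl q (x (suc n)) (inv q) (b n) ⟩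
    - (q * inv q) * x (suc n) * b n
      ≡⟨ cong₂ (λ u v → - u * v * b n) (inv-inverseʳ q≢0) (^-2*suc q n) ⟩
    - 1ℚ * (q ^ 2 * x n) * (1ℚ - x (suc n))
      ≡⟨ solve 3 (λ q y y′ → con (- 1ℚ) :* ((q :* (q :* con 1ℚ)) :* y) :* (con 1ℚ :- y′) := (q :* y′ :- q) :* (q :* y))
               refl q (x n) (x (suc n)) ⟩
    (q * x (suc n) - q) * (q * x n)
      ≡⟨ cong₂ (λ u v → (u - q) * v) (sym (^-2*suc∸1 q (suc n))) (sym (^-2*suc∸1 q n)) ⟩
    a n * W-weight n
      ∎

  Wbar-closed-form : q ≢ 0ℚ → q * q ≢ 1ℚ → ∀ n → Wbar q (suc n) ≡ W-weight n * G (- inv q) W-coeff n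
  Wbar-closed-form q≢0 q²≢1 =
    solution-as-product {a} {b} {d} W-weight (G (- inv q) W-coeff) (λ n → Wbar q (suc n))
      (W-weight-suc q≢0) (G-suc (- inv q) W-coeff refl W-coeff-suc q²≢1) (λ _ → refl)
      (solve 4 (λ q i j p → q :* i := (q :* con 1ℚ) :* (i :- (:- j) :* (p :* con 0ℚ)))
         refl q (inv (1ℚ + q ^ 2)) (inv q) (prefactor 0))

  Wrhs-closed-form : q ≢ 0ℚ → ∀ n → Wrhs q (suc n) ≡ W-weight n * G (- inv q) W-coeff n
  Wrhs-closed-form q≢0 n = begin
    q ^ (2 ℕ.* suc n ℕ.∸ 1) * i + q ^ (2 ℕ.* suc n ℕ.∸ 2) * p * s
      ≡⟨ cong₂ (λ u v → u * i + v * p * s) (^-2*suc∸1 q n) (^-2*suc∸2 q n) ⟩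
    q * x n * i + x n * p * s
      ≡⟨ cong (λ u → q * x n * i + u * p * s) (sym (*-identityʳ (x n))) ⟩
    q * x n * i + x n * 1ℚ * p * s
      ≡⟨ cong (λ u → q * x n * i + x n * u * p * s) (sym (inv-inverseʳ q≢0)) ⟩
    q * x n * i + x n * (q * inv q) * p * s
      ≡⟨ solve 6 (λ q y i j p s → q :* y :* i :+ y :* (q :* j) :* p :* s := q :* y :* (i :- (:- j) :* (p :* s)))
               refl q (x n) i (inv q) p s ⟩
    q * x n * (i - - inv q * (p * s))
      ≡⟨ cong (_* G (- inv q) W-coeff n) (sym (^-2*suc∸1 q n)) ⟩
    W-weight n * G (- inv q) W-coeff n
      ∎
    where
    p s i : ℚ
    p = prefactor n
    s = weightedSum W-coeff n
    i = inv (1ℚ + x (suc n))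

theorem2p5 : (q : ℚ) → q ≢ 0ℚ → q * q ≢ 1ℚ → (k : ℕ) → 1 ≤ k →
    (Vbar q k ≡ Vrhs q k) × (Wbar q k ≡ Wrhs q k)
theorem2p5 q q≢0 q²≢1 (suc n) _ =
  trans (Vbar-closed-form q q²≢1 n) (sym (Vrhs-closed-form q n)) ,
  trans (Wbar-closed-form q q≢0 q²≢1 n) (sym (Wrhs-closed-form q q≢0 n))
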